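{- Let $\sigma\ge2$ be an integer, $\mu=1/\sigma$, $f_d(\lambda)=\lambda^{d+1}-\lambda^d-\mu^{d+1}+\mu^d$, and let $A_d$ be the $d\times d$ matrix whose first row is $(1-\mu,\dots,1-\mu)$, whose subdiagonal entries $(A_d)_{i+1,i}$ ($1\le i\le d-1$) equal $\mu$, and all of whose other entries are $0$. For all sufficiently large $d$ the following holds: if $\lambda_0$ is a real root of $f_d$ with $1-\mu^d<\lambda_0<1-\mu^{d+1}$ and $s=\mu/\lambda_0$, then $\nu_0=(1,s,s^2,\dots,s^{d-1})^T$ is a right eigenvector of $A_d$ with eigenvalue $\lambda_0$, and $\|\nu_0\|_1<3$. -}

module Defs where

open import Level using (0ℓ)
open import Data.Nat as ℕ using (ℕ; zero; suc)
open import Data.Fin using (Fin; toℕ)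
import Data.Fin as Fin
open import Data.Product using (∃; _×_; _,_)
open import Data.Sum using (_⊎_)
open import Relation.Nullary using (¬_)
open import Relation.Binary.PropositionalEquality using (_≡_)
open import Relation.Binary.Structures using (IsStrictTotalOrder)
open import Relation.Binary.Definitions using (tri<; tri≈; tri>)
open import Algebra.Structures using (IsCommutativeRing)

-- An axiomatisation of the real numbers: a complete (Dedekind / least upper
-- bound) ordered field.  Any model is (classically) isomorphic to ℝ.
record RealField : Set₁ where
  infixl 6 _+_
  infixl 7 _*_
  infix 4 _<_
  field
    Carrier : Set
    _+_ _*_ : Carrier → Carrier → Carrier
    -_      : Carrier → Carrier
    0# 1#   : Carrier
    _⁻¹     : Carrier → Carrier
    _<_     : Carrier → Carrier → Set
    isCommutativeRing  : IsCommutativeRing _≡_ _+_ _*_ -_ 0# 1#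
    ⁻¹-inverse         : ∀ x → ¬ (x ≡ 0#) → x * (x ⁻¹) ≡ 1#
    isStrictTotalOrder : IsStrictTotalOrder _≡_ _<_
    0<1                : 0# < 1#
    +-mono-<           : ∀ {x y} z → x < y → x + z < y + z
    *-pos              : ∀ {x y} → 0# < x → 0# < y → 0# < x * y

    -- least upper bound property (x ≤ y written as x < y ⊎ x ≡ y)
    sup : (P : Carrier → Set) → (∃ λ x → P x) →
          (∃ λ b → ∀ x → P x → (x < b) ⊎ (x ≡ b)) →
          ∃ λ s → (∀ x → P x → (x < s) ⊎ (x ≡ s)) ×
                  (∀ b → (∀ x → P x → (x < b) ⊎ (x ≡ b)) → (s < b) ⊎ (s ≡ b))

module RealFieldOps (R : RealField) where
  open RealField R public
  infixl 6 _-_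
  infix 4 _≤_

  _-_ : Carrier → Carrier → Carrier
  x - y = x + (- y)

  _≤_ : Carrier → Carrier → Set
  x ≤ y = (x < y) ⊎ (x ≡ y)

  open IsStrictTotalOrder isStrictTotalOrder using (compare)

  fromℕ : ℕ → Carrier
  fromℕ zero    = 0#
  fromℕ (suc n) = 1# + fromℕ n

  infixr 8 _^_
  _^_ : Carrier → ℕ → Carrier
  x ^ zero  = 1#
  x ^ suc n = x * (x ^ n)

  ∣_∣ : Carrier → Carrier
  ∣ x ∣ with compare x 0#
  ... | tri< _ _ _ = - x
  ... | tri≈ _ _ _ = x
  ... | tri> _ _ _ = x

  Σ : ∀ {n} → (Fin n → Carrier) → Carrier
  Σ {zero}  v = 0#
  Σ {suc n} v = v Fin.zero + Σ (λ i → v (Fin.suc i))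

  ‖_‖₁ : ∀ {d} → (Fin d → Carrier) → Carrier
  ‖ v ‖₁ = Σ (λ i → ∣ v i ∣)

  -- matrix–vector product (matrices as Fin d → Fin d → Carrier, row then column)
  _·ᵥ_ : ∀ {d} → (Fin d → Fin d → Carrier) → (Fin d → Carrier) → (Fin d → Carrier)
  (M ·ᵥ v) i = Σ (λ j → M i j * v j)

  μ : ℕ → Carrier
  μ σ = (fromℕ σ) ⁻¹

  f : ℕ → ℕ → Carrier → Carrier
  f σ d l = l ^ suc d - l ^ d - μ σ ^ suc d + μ σ ^ d

  -- A_d (0-indexed): row 0 is (1-μ,…,1-μ); entry (j+1, j) is μ; else 0.
  A : ℕ → (d : ℕ) → Fin d → Fin d → Carrier
  A σ d i j with toℕ i
  ... | zero = 1# - μ σ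
  ... | suc i' with i' ℕ.≟ toℕ j
  ...   | Relation.Nullary.yes _ = μ σ
  ...   | Relation.Nullary.no _  = 0#

  ν : (d : ℕ) → Carrier → Fin d → Carrier
  ν d s i = s ^ toℕ i

module Submission where

-- The proof is elementary algebra in an ordered field.
--  * An integer-coefficient ring solver is set up for any commutative ring, by
--    the canonical homomorphism ℤ → R; it discharges all polynomial identities.
--  * Rows 2, …, d of A_d are shifts scaled by μ, so they satisfy A ν = λ ν as
--    soon as s λ = μ.  Row 1 reads (1 - μ)(1 + s + ⋯ + s^{d-1}) = λ; multiplying
--    by (1 - s) λ^d and using the geometric sum, this is exactly f_d(λ) = 0.
--  * Since μ ≤ 1/2 and λ > 1 - μ^d ≥ 1 - μ², one gets 2λ > 3μ, i.e. s < 2/3;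
--    then ‖ν‖₁ = (1 - s^d)/(1 - s) < 3.

open import Defs
open import Data.Nat as ℕ using (ℕ; zero; suc; _≤_; s≤s)
import Data.Nat.Properties as ℕₚ
open import Data.Integer as ℤ using (ℤ; -[1+_])
import Data.Integer.Properties as ℤₚ
import Data.Sign as Sign
open import Data.Fin as Fin using (Fin; toℕ)
import Data.Fin.Properties as Finₚ
open import Data.Maybe using (Maybe; just; nothing)
open import Data.Product using (∃; _×_; _,_)
open import Data.Sum using (inj₁; inj₂)
open import Data.Empty using (⊥-elim)
open import Relation.Nullary using (¬_; yes; no)
import Relation.Binary.PropositionalEquality as ≡
open ≡ using (_≡_)
open import Relation.Binary.Structures using (IsStrictTotalOrder)
open import Relation.Binary.Definitions using (tri<; tri≈; tri>)
open import Algebra.Bundles using (CommutativeRing)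
import Algebra.Solver.Ring.AlmostCommutativeRing as ACR
import Algebra.Solver.Ring as RingSolver

module IntegerCoefficientSolver {c ℓ} (R : CommutativeRing c ℓ) where
  open CommutativeRing R
  open import Algebra.Properties.Ring ring using (-0#≈0#; -‿involutive; -‿+-comm; -‿distribˡ-*; -‿distribʳ-*)
  open import Algebra.Properties.Semiring.Mult.TCOptimised semiring
    using (1+×; ×-homo-+; ×1-homo-*) renaming (_×_ to _×′_)
  open import Relation.Binary.Reasoning.Setoid setoid

  -- The canonical map ℤ → R; n ↦ n ×′ 1#, where 1 ×′ 1# is 1# definitionally.
  ⟦_⟧ℤ : ℤ → Carrier
  ⟦ ℤ.+ n ⟧ℤ     = n ×′ 1#
  ⟦ -[1+ n ] ⟧ℤ = - (suc n ×′ 1#)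

  +1-diff : ∀ a b → a - b ≈ (1# + a) - (1# + b)
  +1-diff a b = begin
    a - b                      ≈⟨ +-identityˡ (a - b) ⟨
    0# + (a - b)               ≈⟨ +-congʳ (-‿inverseʳ 1#) ⟨
    (1# - 1#) + (a - b)        ≈⟨ +-assoc 1# (- 1#) (a - b) ⟩
    1# + (- 1# + (a - b))      ≈⟨ +-congˡ (+-assoc (- 1#) a (- b)) ⟨
    1# + ((- 1# + a) - b)      ≈⟨ +-congˡ (+-congʳ (+-comm (- 1#) a)) ⟩
    1# + ((a - 1#) - b)        ≈⟨ +-congˡ (+-assoc a (- 1#) (- b)) ⟩
    1# + (a + (- 1# - b))      ≈⟨ +-assoc 1# a (- 1# - b) ⟨
    (1# + a) + (- 1# - b)      ≈⟨ +-congˡ (-‿+-comm 1# b) ⟩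
    (1# + a) - (1# + b)        ∎

  ⊖-homo : ∀ m n → ⟦ m ℤ.⊖ n ⟧ℤ ≈ m ×′ 1# - n ×′ 1#
  ⊖-homo m       zero    = sym (trans (+-congˡ -0#≈0#) (+-identityʳ _))
  ⊖-homo zero    (suc n) = sym (+-identityˡ _)
  ⊖-homo (suc m) (suc n) = begin
    ⟦ suc m ℤ.⊖ suc n ⟧ℤ             ≡⟨ ≡.cong ⟦_⟧ℤ (ℤₚ.[1+m]⊖[1+n]≡m⊖n m n) ⟩
    ⟦ m ℤ.⊖ n ⟧ℤ                     ≈⟨ ⊖-homo m n ⟩
    m ×′ 1# - n ×′ 1#                ≈⟨ +1-diff (m ×′ 1#) (n ×′ 1#) ⟩
    (1# + m ×′ 1#) - (1# + n ×′ 1#)  ≈⟨ +-cong (1+× m 1#) (-‿cong (1+× n 1#)) ⟨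
    suc m ×′ 1# - suc n ×′ 1#        ∎

  ◃-homo⁺ : ∀ k → ⟦ Sign.+ ℤ.◃ k ⟧ℤ ≈ k ×′ 1#
  ◃-homo⁺ zero    = refl
  ◃-homo⁺ (suc k) = refl

  ◃-homo⁻ : ∀ k → ⟦ Sign.- ℤ.◃ k ⟧ℤ ≈ - (k ×′ 1#)
  ◃-homo⁻ zero    = sym -0#≈0#
  ◃-homo⁻ (suc k) = refl

  +-homo : ∀ i j → ⟦ i ℤ.+ j ⟧ℤ ≈ ⟦ i ⟧ℤ + ⟦ j ⟧ℤ
  +-homo (ℤ.+ m)   (ℤ.+ n)   = ×-homo-+ 1# m n
  +-homo (ℤ.+ m)   -[1+ n ] = ⊖-homo m (suc n)
  +-homo -[1+ m ] (ℤ.+ n)   = trans (⊖-homo n (suc m)) (+-comm _ _)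
  +-homo -[1+ m ] -[1+ n ] = begin
    - (suc (suc (m ℕ.+ n)) ×′ 1#)      ≡⟨ ≡.cong (λ k → - (suc k ×′ 1#)) (ℕₚ.+-suc m n) ⟨
    - ((suc m ℕ.+ suc n) ×′ 1#)        ≈⟨ -‿cong (×-homo-+ 1# (suc m) (suc n)) ⟩
    - (suc m ×′ 1# + suc n ×′ 1#)      ≈⟨ -‿+-comm _ _ ⟨
    - (suc m ×′ 1#) + - (suc n ×′ 1#)  ∎

  *-homo : ∀ i j → ⟦ i ℤ.* j ⟧ℤ ≈ ⟦ i ⟧ℤ * ⟦ j ⟧ℤ
  *-homo (ℤ.+ m)   (ℤ.+ n)   = trans (◃-homo⁺ (m ℕ.* n)) (×1-homo-* m n)
  *-homo (ℤ.+ m)   -[1+ n ] =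
    trans (◃-homo⁻ (m ℕ.* suc n)) (trans (-‿cong (×1-homo-* m (suc n))) (-‿distribʳ-* _ _))
  *-homo -[1+ m ] (ℤ.+ n)   =
    trans (◃-homo⁻ (suc m ℕ.* n)) (trans (-‿cong (×1-homo-* (suc m) n)) (-‿distribˡ-* _ _))
  *-homo -[1+ m ] -[1+ n ] = begin
    (suc m ℕ.* suc n) ×′ 1#  ≈⟨ ×1-homo-* (suc m) (suc n) ⟩
    a * b                    ≈⟨ -‿involutive (a * b) ⟨
    - - (a * b)              ≈⟨ -‿cong (-‿distribˡ-* a b) ⟩
    - (- a * b)              ≈⟨ -‿distribʳ-* (- a) b ⟩
    - a * - b                ∎
    where
    a b : Carrier
    a = suc m ×′ 1#
    b = suc n ×′ 1#

  neg-homo : ∀ i → ⟦ ℤ.- i ⟧ℤ ≈ - ⟦ i ⟧ℤ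
  neg-homo (ℤ.+ zero)  = sym -0#≈0#
  neg-homo (ℤ.+ suc n) = refl
  neg-homo -[1+ n ]   = sym (-‿involutive _)

  homomorphism : ℤ.+-*-rawRing ACR.-Raw-AlmostCommutative⟶ ACR.fromCommutativeRing R
  homomorphism = record
    { ⟦_⟧ = ⟦_⟧ℤ ; +-homo = +-homo ; *-homo = *-homo ; -‿homo = neg-homo
    ; 0-homo = refl ; 1-homo = refl }

  -- Equal integer coefficients have equal images (the solver only needs this weak test).
  coefficient-test : ∀ i j → Maybe (⟦ i ⟧ℤ ≈ ⟦ j ⟧ℤ)
  coefficient-test i j with i ℤ.≟ j
  ... | yes ≡.refl = just refl
  ... | no _       = nothing

  open RingSolver ℤ.+-*-rawRing (ACR.fromCommutativeRing R) homomorphism coefficient-test public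
    using (Polynomial; solve; _:=_; _:+_; _:*_; _:-_; con)

  one : ∀ {n} → Polynomial n
  one = con (ℤ.+ 1)

  -- The numeral k as a constant polynomial; it evaluates to 1# + (1# + ⋯ + 0#),
  -- which is definitionally Defs.fromℕ k in a real field.
  numeral : ∀ {n} → ℕ → Polynomial n
  numeral zero    = con (ℤ.+ 0)
  numeral (suc k) = one :+ numeral k

module DominantEigenvector (R : RealField) where
  open RealFieldOps R renaming (_≤_ to _≤ᴿ_)
  open ≡ using (_≢_; refl; sym; trans; cong; cong₂; subst; subst₂; module ≡-Reasoning)
  open ≡-Reasoning

  commutativeRing : CommutativeRing _ _
  commutativeRing = record { isCommutativeRing = isCommutativeRing }

  open CommutativeRing commutativeRing
    using (+-assoc; +-comm; +-identityˡ; +-identityʳ; *-assoc; *-identityʳ; -‿inverseʳ; distribˡ; zeroˡ; zeroʳ)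
  open import Algebra.Properties.Ring (CommutativeRing.ring commutativeRing) using (-‿distribʳ-*; -‿+-comm)
  open IntegerCoefficientSolver commutativeRing using (solve; _:=_; _:+_; _:*_; _:-_; one; numeral)
  open IsStrictTotalOrder isStrictTotalOrder using (compare) renaming (trans to <-trans; irrefl to <-irrefl)

  <-irreflexive : ∀ {x} → ¬ (x < x)
  <-irreflexive = <-irrefl refl

  pos⇒≢0 : ∀ {x} → 0# < x → x ≢ 0#
  pos⇒≢0 0<x x≡0 = <-irrefl (sym x≡0) 0<x

  pos+pos : ∀ {x y} → 0# < x → 0# < y → 0# < x + y
  pos+pos {x} {y} 0<x 0<y = <-trans 0<y (subst (_< x + y) (+-identityˡ y) (+-mono-< y 0<x))

  pos+nonneg : ∀ {x y} → 0# < x → 0# ≤ᴿ y → 0# < x + y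
  pos+nonneg 0<x       (inj₁ 0<y)  = pos+pos 0<x 0<y
  pos+nonneg {x} 0<x   (inj₂ refl) = subst (0# <_) (sym (+-identityʳ x)) 0<x

  nonneg+nonneg : ∀ {x y} → 0# ≤ᴿ x → 0# ≤ᴿ y → 0# ≤ᴿ x + y
  nonneg+nonneg (inj₁ 0<x)  0≤y = inj₁ (pos+nonneg 0<x 0≤y)
  nonneg+nonneg (inj₂ refl) 0≤y = subst (0# ≤ᴿ_) (sym (+-identityˡ _)) 0≤y

  nonneg*nonneg : ∀ {x y} → 0# ≤ᴿ x → 0# ≤ᴿ y → 0# ≤ᴿ x * y
  nonneg*nonneg (inj₁ 0<x)  (inj₁ 0<y)  = inj₁ (*-pos 0<x 0<y)
  nonneg*nonneg (inj₂ refl) _           = inj₂ (sym (zeroˡ _))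
  nonneg*nonneg (inj₁ _)    (inj₂ refl) = inj₂ (sym (zeroʳ _))

  <⇒pos-diff : ∀ {x y} → x < y → 0# < y - x
  <⇒pos-diff {x} {y} x<y = subst (_< y - x) (-‿inverseʳ x) (+-mono-< (- x) x<y)

  pos-increment⇒< : ∀ {e x y} → 0# < e → y ≡ x + e → x < y
  pos-increment⇒< {e} {x} 0<e refl = subst₂ _<_ (+-identityˡ x) (+-comm e x) (+-mono-< x 0<e)

  neg⇒neg-pos : ∀ {x} → x < 0# → 0# < - x
  neg⇒neg-pos {x} x<0 = subst (0# <_) (+-identityˡ (- x)) (<⇒pos-diff x<0)

  -- A positive element has a positive inverse: the other two trichotomy cases
  -- would force 0 = 1 or 0 < -1.
  ⁻¹-pos : ∀ {x} → 0# < x → 0# < x ⁻¹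
  ⁻¹-pos {x} 0<x with compare (x ⁻¹) 0#
  ... | tri> _ _ 0<x⁻¹ = 0<x⁻¹
  ... | tri≈ _ x⁻¹≡0 _ = ⊥-elim (<-irrefl 0≡1 0<1)
    where
    0≡1 : 0# ≡ 1#
    0≡1 = trans (sym (zeroʳ x)) (trans (cong (x *_) (sym x⁻¹≡0)) (⁻¹-inverse x (pos⇒≢0 0<x)))
  ... | tri< x⁻¹<0 _ _ = ⊥-elim (<-irreflexive (subst (0# <_) (-‿inverseʳ 1#) (pos+pos 0<1 0<-1)))
    where
    0<-1 : 0# < - 1#
    0<-1 = subst (0# <_) (trans (sym (-‿distribʳ-* x (x ⁻¹))) (cong -_ (⁻¹-inverse x (pos⇒≢0 0<x))))
                 (*-pos 0<x (neg⇒neg-pos x⁻¹<0))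

  halve-pos : ∀ {x} → 0# < x + x → 0# < x
  halve-pos {x} 0<2x with compare x 0#
  ... | tri> _ _ 0<x = 0<x
  ... | tri≈ _ refl _ = ⊥-elim (<-irreflexive (subst (0# <_) (+-identityʳ 0#) 0<2x))
  ... | tri< x<0 _ _ = ⊥-elim (<-irreflexive (subst (0# <_) (-‿inverseʳ (x + x)) (pos+pos 0<2x 0<-2x)))
    where
    0<-2x : 0# < - (x + x)
    0<-2x = subst (0# <_) (-‿+-comm x x) (pos+pos (neg⇒neg-pos x<0) (neg⇒neg-pos x<0))

  *-cancelʳ : ∀ {a b c} → c ≢ 0# → a * c ≡ b * c → a ≡ b
  *-cancelʳ {a} {b} {c} c≢0 ac≡bc = begin
    a                ≡⟨ sym (*-identityʳ a) ⟩
    a * 1#           ≡⟨ cong (a *_) (sym (⁻¹-inverse c c≢0)) ⟩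
    a * (c * c ⁻¹)   ≡⟨ sym (*-assoc a c (c ⁻¹)) ⟩
    (a * c) * c ⁻¹   ≡⟨ cong (_* c ⁻¹) ac≡bc ⟩
    (b * c) * c ⁻¹   ≡⟨ *-assoc b c (c ⁻¹) ⟩
    b * (c * c ⁻¹)   ≡⟨ cong (b *_) (⁻¹-inverse c c≢0) ⟩
    b * 1#           ≡⟨ *-identityʳ b ⟩
    b                ∎

  *-⁻¹-cancel : ∀ {x y} → y ≢ 0# → (x * y ⁻¹) * y ≡ x
  *-⁻¹-cancel {x} {y} y≢0 = begin
    (x * y ⁻¹) * y   ≡⟨ solve 3 (λ x i y → x :* i :* y := x :* (y :* i)) refl x (y ⁻¹) y ⟩
    x * (y * y ⁻¹)   ≡⟨ cong (x *_) (⁻¹-inverse y y≢0) ⟩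
    x * 1#           ≡⟨ *-identityʳ x ⟩
    x                ∎

  ∣∣-pos : ∀ {x} → 0# < x → ∣ x ∣ ≡ x
  ∣∣-pos {x} 0<x with compare x 0#
  ... | tri< x<0 _ _ = ⊥-elim (<-irreflexive (<-trans x<0 0<x))
  ... | tri≈ _ _ _   = refl
  ... | tri> _ _ _   = refl

  ^-pos : ∀ {x} n → 0# < x → 0# < x ^ n
  ^-pos zero    0<x = 0<1
  ^-pos (suc n) 0<x = *-pos 0<x (^-pos n 0<x)

  ^-distribʳ-* : ∀ x y n → (x * y) ^ n ≡ x ^ n * y ^ n
  ^-distribʳ-* x y zero    = sym (*-identityʳ 1#)
  ^-distribʳ-* x y (suc n) = begin
    (x * y) * (x * y) ^ n
      ≡⟨ cong ((x * y) *_) (^-distribʳ-* x y n) ⟩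
    (x * y) * (x ^ n * y ^ n)
      ≡⟨ solve 4 (λ x y X Y → (x :* y) :* (X :* Y) := (x :* X) :* (y :* Y)) refl x y (x ^ n) (y ^ n) ⟩
    (x * x ^ n) * (y * y ^ n)
      ∎

  1-^-nonneg : ∀ {x} n → 0# < x → 0# ≤ᴿ 1# - x → 0# ≤ᴿ 1# - x ^ n
  1-^-nonneg zero    _   _      = inj₂ (sym (-‿inverseʳ 1#))
  1-^-nonneg {x} (suc n) 0<x 0≤1-x = subst (0# ≤ᴿ_) (sym split)
    (nonneg+nonneg 0≤1-x (nonneg*nonneg (inj₁ 0<x) (1-^-nonneg n 0<x 0≤1-x)))
    where
    split : 1# - x * x ^ n ≡ (1# - x) + x * (1# - x ^ n)
    split = solve 2 (λ x X → one :- x :* X := (one :- x) :+ x :* (one :- X)) refl x (x ^ n)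

  fromℕ-+ : ∀ m n → fromℕ (m ℕ.+ n) ≡ fromℕ m + fromℕ n
  fromℕ-+ zero    n = sym (+-identityˡ (fromℕ n))
  fromℕ-+ (suc m) n = trans (cong (1# +_) (fromℕ-+ m n)) (sym (+-assoc 1# (fromℕ m) (fromℕ n)))

  fromℕ-nonneg : ∀ n → 0# ≤ᴿ fromℕ n
  fromℕ-nonneg zero    = inj₂ refl
  fromℕ-nonneg (suc n) = inj₁ (pos+nonneg 0<1 (fromℕ-nonneg n))

  fromℕ-pos : ∀ n → 0# < fromℕ (suc n)
  fromℕ-pos n = pos+nonneg 0<1 (fromℕ-nonneg n)

  Σ-cong : ∀ {d} {v w : Fin d → Carrier} → (∀ i → v i ≡ w i) → Σ v ≡ Σ w
  Σ-cong {zero}  v≡w = refl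
  Σ-cong {suc d} v≡w = cong₂ _+_ (v≡w Fin.zero) (Σ-cong (λ i → v≡w (Fin.suc i)))

  Σ-scale : ∀ {d} c (v : Fin d → Carrier) → Σ (λ j → c * v j) ≡ c * Σ v
  Σ-scale {zero}  c v = sym (zeroʳ c)
  Σ-scale {suc d} c v = trans (cong (c * v Fin.zero +_) (Σ-scale c (λ j → v (Fin.suc j))))
                              (sym (distribˡ c (v Fin.zero) (Σ (λ j → v (Fin.suc j)))))

  Σ-nonneg : ∀ {d} (v : Fin d → Carrier) → (∀ i → 0# ≤ᴿ v i) → 0# ≤ᴿ Σ v
  Σ-nonneg {zero}  v 0≤v = inj₂ refl
  Σ-nonneg {suc d} v 0≤v =
    nonneg+nonneg (0≤v Fin.zero) (Σ-nonneg (λ j → v (Fin.suc j)) (λ j → 0≤v (Fin.suc j)))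

  Σ-zero : ∀ {d} (v : Fin d → Carrier) → (∀ i → v i ≡ 0#) → Σ v ≡ 0#
  Σ-zero {zero}  v v≡0 = refl
  Σ-zero {suc d} v v≡0 =
    trans (cong₂ _+_ (v≡0 Fin.zero) (Σ-zero (λ j → v (Fin.suc j)) (λ j → v≡0 (Fin.suc j)))) (+-identityʳ 0#)

  Σ-single : ∀ {d} (k : Fin d) (v : Fin d → Carrier) → (∀ j → j ≢ k → v j ≡ 0#) → Σ v ≡ v k
  Σ-single Fin.zero    v off = trans (cong (v Fin.zero +_) (Σ-zero _ (λ j → off (Fin.suc j) λ ())))
                                     (+-identityʳ (v Fin.zero))
  Σ-single (Fin.suc k) v off =
    trans (cong₂ _+_ (off Fin.zero λ ()) (Σ-single k (λ j → v (Fin.suc j)) off′)) (+-identityˡ (v (Fin.suc k)))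
    where
    off′ : ∀ j → j ≢ k → v (Fin.suc j) ≡ 0#
    off′ j j≢k = off (Fin.suc j) (λ sj≡sk → j≢k (Finₚ.suc-injective sj≡sk))

  geometric-sum : ∀ s d → (1# - s) * Σ {d} (λ j → s ^ toℕ j) ≡ 1# - s ^ d
  geometric-sum s zero    = trans (zeroʳ (1# - s)) (sym (-‿inverseʳ 1#))
  geometric-sum s (suc d) = begin
    (1# - s) * (1# + Σ {d} (λ j → s * s ^ toℕ j))
      ≡⟨ cong (λ u → (1# - s) * (1# + u)) (Σ-scale {d} s (λ j → s ^ toℕ j)) ⟩
    (1# - s) * (1# + s * G)
      ≡⟨ solve 2 (λ s G → (one :- s) :* (one :+ s :* G) := (one :- s) :+ s :* ((one :- s) :* G)) refl s G ⟩
    (1# - s) + s * ((1# - s) * G)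
      ≡⟨ cong (λ u → (1# - s) + s * u) (geometric-sum s d) ⟩
    (1# - s) + s * (1# - s ^ d)
      ≡⟨ solve 2 (λ s S → (one :- s) :+ s :* (one :- S) := one :- s :* S) refl s (s ^ d) ⟩
    1# - s * s ^ d
      ∎
    where
    G : Carrier
    G = Σ {d} (λ j → s ^ toℕ j)

  A-first-row : ∀ σ {d} (v : Fin (suc d) → Carrier) → (A σ (suc d) ·ᵥ v) Fin.zero ≡ (1# - μ σ) * Σ v
  A-first-row σ v = Σ-scale (1# - μ σ) v

  A-subdiagonal : ∀ σ {d} (i : Fin d) → A σ (suc d) (Fin.suc i) (Fin.inject₁ i) ≡ μ σ
  A-subdiagonal σ i with toℕ i ℕ.≟ toℕ (Fin.inject₁ i)
  ... | yes _ = refl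
  ... | no ≢  = ⊥-elim (≢ (sym (Finₚ.toℕ-inject₁ i)))

  A-off-subdiagonal : ∀ σ {d} (i : Fin d) j → j ≢ Fin.inject₁ i → A σ (suc d) (Fin.suc i) j ≡ 0#
  A-off-subdiagonal σ i j j≢i with toℕ i ℕ.≟ toℕ j
  ... | yes i≡j = ⊥-elim (j≢i (Finₚ.toℕ-injective (trans (sym i≡j) (sym (Finₚ.toℕ-inject₁ i)))))
  ... | no _    = refl

  A-shift-row : ∀ σ {d} (v : Fin (suc d) → Carrier) (i : Fin d) →
                (A σ (suc d) ·ᵥ v) (Fin.suc i) ≡ μ σ * v (Fin.inject₁ i)
  A-shift-row σ v i =
    trans (Σ-single (Fin.inject₁ i) _ vanish) (cong (_* v (Fin.inject₁ i)) (A-subdiagonal σ i))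
    where
    vanish : ∀ j → j ≢ Fin.inject₁ i → A σ _ (Fin.suc i) j * v j ≡ 0#
    vanish j j≢i = trans (cong (_* v j) (A-off-subdiagonal σ i j j≢i)) (zeroˡ (v j))

  -- The first-row equation (1 - μ)(1 + s + ⋯ + s^{d-1}) = λ for s = μ/λ is
  -- f_d(λ) = 0 divided by the nonzero factor (1 - s) λ^d.
  first-row-balance : ∀ σ d {l} → 0# < μ σ → μ σ < l → f σ d l ≡ 0# →
                      (1# - μ σ) * Σ {d} (λ j → (μ σ * l ⁻¹) ^ toℕ j) ≡ l
  first-row-balance σ d {l} 0<m m<l root = *-cancelʳ (pos⇒≢0 0<c) balance
    where
    m s G L M c : Carrier
    m = μ σ
    s = m * l ⁻¹
    G = Σ {d} (λ j → s ^ toℕ j)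
    L = l ^ d
    M = m ^ d
    c = (1# - s) * L
    0<l : 0# < l
    0<l = <-trans 0<m m<l
    sl≡m : s * l ≡ m
    sl≡m = *-⁻¹-cancel (pos⇒≢0 0<l)
    0<c : 0# < c
    0<c = *-pos (subst (0# <_) 1-s≡ (*-pos (<⇒pos-diff m<l) (⁻¹-pos 0<l))) (^-pos d 0<l)
      where
      1-s≡ : (l - m) * l ⁻¹ ≡ 1# - s
      1-s≡ = begin
        (l - m) * l ⁻¹       ≡⟨ solve 3 (λ l i m → (l :- m) :* i := l :* i :- m :* i) refl l (l ⁻¹) m ⟩
        l * l ⁻¹ - s         ≡⟨ cong (_- s) (⁻¹-inverse l (pos⇒≢0 0<l)) ⟩
        1# - s               ∎
    balance : ((1# - m) * G) * c ≡ l * c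
    balance = begin
      ((1# - m) * G) * ((1# - s) * L)
        ≡⟨ solve 4 (λ m G s L → ((one :- m) :* G) :* ((one :- s) :* L)
                                := ((one :- m) :* ((one :- s) :* G)) :* L) refl m G s L ⟩
      ((1# - m) * ((1# - s) * G)) * L
        ≡⟨ cong (λ u → ((1# - m) * u) * L) (geometric-sum s d) ⟩
      ((1# - m) * (1# - s ^ d)) * L
        ≡⟨ solve 3 (λ m S L → ((one :- m) :* (one :- S)) :* L := (one :- m) :* (L :- S :* L)) refl m (s ^ d) L ⟩
      (1# - m) * (L - s ^ d * L)
        ≡⟨ cong (λ u → (1# - m) * (L - u)) (trans (sym (^-distribʳ-* s l d)) (cong (_^ d) sl≡m)) ⟩
      (1# - m) * (L - M)
        ≡⟨ solve 4 (λ m L M l → (one :- m) :* (L :- M)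
                                := (l :- m) :* L :- (l :* L :- L :- m :* M :+ M)) refl m L M l ⟩
      (l - m) * L - f σ d l
        ≡⟨ cong (λ u → (l - m) * L - u) root ⟩
      (l - m) * L - 0#
        ≡⟨ cong (λ u → (l - u) * L - 0#) (sym sl≡m) ⟩
      (l - s * l) * L - 0#
        ≡⟨ solve 3 (λ l s L → (l :- s :* l) :* L :- numeral 0 := l :* ((one :- s) :* L)) refl l s L ⟩
      l * ((1# - s) * L)
        ∎

  ν-eigenvector : ∀ σ d {l} → 0# < μ σ → μ σ < l → f σ d l ≡ 0# →
                  ∀ i → (A σ d ·ᵥ ν d (μ σ * l ⁻¹)) i ≡ l * ν d (μ σ * l ⁻¹) i
  ν-eigenvector σ (suc d) {l} 0<m m<l root Fin.zero =
    trans (A-first-row σ (ν (suc d) s)) (trans (first-row-balance σ (suc d) 0<m m<l root) (sym (*-identityʳ l)))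
    where
    s : Carrier
    s = μ σ * l ⁻¹
  ν-eigenvector σ (suc d) {l} 0<m m<l root (Fin.suc i) = begin
    (A σ (suc d) ·ᵥ ν (suc d) s) (Fin.suc i)
      ≡⟨ A-shift-row σ (ν (suc d) s) i ⟩
    μ σ * s ^ toℕ (Fin.inject₁ i)
      ≡⟨ cong (λ n → μ σ * s ^ n) (Finₚ.toℕ-inject₁ i) ⟩
    μ σ * s ^ toℕ i
      ≡⟨ cong (_* s ^ toℕ i) (sym (*-⁻¹-cancel (pos⇒≢0 (<-trans 0<m m<l)))) ⟩
    (s * l) * s ^ toℕ i
      ≡⟨ solve 3 (λ s l X → (s :* l) :* X := l :* (s :* X)) refl s l (s ^ toℕ i) ⟩
    l * (s * s ^ toℕ i)
      ∎
    where
    s : Carrier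
    s = μ σ * l ⁻¹

  -- For 0 < s < 2/3 the geometric sum is below 3, since
  -- 3 = G + 3 s^d + (2 - 3s) G  where  G = 1 + s + ⋯ + s^{d-1}.
  geometric-sum-bound : ∀ d {s} → 0# < s → 0# < fromℕ 2 - fromℕ 3 * s →
                        Σ {d} (λ j → s ^ toℕ j) < fromℕ 3
  geometric-sum-bound d {s} 0<s 0<2-3s = pos-increment⇒< 0<rest three≡
    where
    G rest : Carrier
    G = Σ {d} (λ j → s ^ toℕ j)
    rest = fromℕ 3 * s ^ d + (fromℕ 2 - fromℕ 3 * s) * G
    0<rest : 0# < rest
    0<rest = pos+nonneg (*-pos (fromℕ-pos 2) (^-pos d 0<s))
                        (nonneg*nonneg (inj₁ 0<2-3s) (Σ-nonneg {d} _ (λ j → inj₁ (^-pos (toℕ j) 0<s))))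
    three≡ : fromℕ 3 ≡ G + rest
    three≡ = begin
      fromℕ 3
        ≡⟨ solve 1 (λ S → numeral 3 := numeral 3 :* (one :- S) :+ numeral 3 :* S) refl (s ^ d) ⟩
      fromℕ 3 * (1# - s ^ d) + fromℕ 3 * s ^ d
        ≡⟨ cong (λ u → fromℕ 3 * u + fromℕ 3 * s ^ d) (sym (geometric-sum s d)) ⟩
      fromℕ 3 * ((1# - s) * G) + fromℕ 3 * s ^ d
        ≡⟨ solve 3 (λ s G S → numeral 3 :* ((one :- s) :* G) :+ numeral 3 :* S
                               := G :+ (numeral 3 :* S :+ (numeral 2 :- numeral 3 :* s) :* G)) refl s G (s ^ d) ⟩
      G + rest
        ∎

  -- The entries of ν are positive, so its ℓ¹ norm is the geometric sum.
  ν-norm-bound : ∀ d {s} → 0# < s → 0# < fromℕ 2 - fromℕ 3 * s → ‖ ν d s ‖₁ < fromℕ 3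
  ν-norm-bound d 0<s 0<2-3s =
    subst (_< fromℕ 3) (Σ-cong {d} (λ i → sym (∣∣-pos (^-pos (toℕ i) 0<s)))) (geometric-sum-bound d 0<s 0<2-3s)

  -- If 0 < x ≤ 1/2 and l > 1 - x^{k+2} ≥ 1 - x², then 2l > 3x, because
  -- 2l - 3x = 2(l - (1 - x^{k+2})) + 2x²(1 - x^k) + (1 - 2x)(2 + x).
  above-three-halves : ∀ k {x l} → 0# < x → 0# ≤ᴿ 1# - fromℕ 2 * x → 1# - x ^ suc (suc k) < l →
                       0# < fromℕ 2 * l - fromℕ 3 * x
  above-three-halves k {x} {l} 0<x 0≤1-2x above = subst (0# <_) (sym decomposition)
    (pos+nonneg (pos+nonneg (*-pos (fromℕ-pos 1) (<⇒pos-diff above))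
                            (nonneg*nonneg (inj₁ (*-pos (fromℕ-pos 1) (*-pos 0<x 0<x))) (1-^-nonneg k 0<x 0≤1-x)))
                (nonneg*nonneg 0≤1-2x (inj₁ (pos+pos (fromℕ-pos 1) 0<x))))
    where
    0≤1-x : 0# ≤ᴿ 1# - x
    0≤1-x = subst (0# ≤ᴿ_) (solve 1 (λ x → (one :- numeral 2 :* x) :+ x := one :- x) refl x)
                  (nonneg+nonneg 0≤1-2x (inj₁ 0<x))
    decomposition : fromℕ 2 * l - fromℕ 3 * x ≡
      fromℕ 2 * (l - (1# - x ^ suc (suc k))) + fromℕ 2 * (x * x) * (1# - x ^ k)
        + (1# - fromℕ 2 * x) * (fromℕ 2 + x)
    decomposition = solve 3 (λ l x P → numeral 2 :* l :- numeral 3 :* x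
      := numeral 2 :* (l :- (one :- x :* (x :* P))) :+ numeral 2 :* (x :* x) :* (one :- P)
           :+ (one :- numeral 2 :* x) :* (numeral 2 :+ x))
      refl l x (x ^ k)

  ratio-bounds : ∀ {x l} → 0# < x → 0# < fromℕ 2 * l - fromℕ 3 * x →
                 x < l × 0# < x * l ⁻¹ × 0# < fromℕ 2 - fromℕ 3 * (x * l ⁻¹)
  ratio-bounds {x} {l} 0<x 0<2l-3x =
    x<l , *-pos 0<x (⁻¹-pos 0<l) , subst (0# <_) scaled (*-pos 0<2l-3x (⁻¹-pos 0<l))
    where
    0<l-x : 0# < l - x
    0<l-x = halve-pos (subst (0# <_) (solve 2 (λ l x → (numeral 2 :* l :- numeral 3 :* x) :+ x
                                                    := (l :- x) :+ (l :- x)) refl l x)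
                                     (pos+pos 0<2l-3x 0<x))
    x<l : x < l
    x<l = pos-increment⇒< 0<l-x (solve 2 (λ l x → l := x :+ (l :- x)) refl l x)
    0<l : 0# < l
    0<l = <-trans 0<x x<l
    scaled : (fromℕ 2 * l - fromℕ 3 * x) * l ⁻¹ ≡ fromℕ 2 - fromℕ 3 * (x * l ⁻¹)
    scaled = begin
      (fromℕ 2 * l - fromℕ 3 * x) * l ⁻¹
        ≡⟨ solve 3 (λ l i x → (numeral 2 :* l :- numeral 3 :* x) :* i
                              := numeral 2 :* (l :* i) :- numeral 3 :* (x :* i)) refl l (l ⁻¹) x ⟩
      fromℕ 2 * (l * l ⁻¹) - fromℕ 3 * (x * l ⁻¹)
        ≡⟨ cong (λ u → fromℕ 2 * u - fromℕ 3 * (x * l ⁻¹)) (⁻¹-inverse l (pos⇒≢0 0<l)) ⟩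
      fromℕ 2 * 1# - fromℕ 3 * (x * l ⁻¹)
        ≡⟨ cong (_- fromℕ 3 * (x * l ⁻¹)) (*-identityʳ (fromℕ 2)) ⟩
      fromℕ 2 - fromℕ 3 * (x * l ⁻¹)
        ∎

  complement : ∀ k t {x} → fromℕ (k ℕ.+ t) * x ≡ 1# → 1# - fromℕ k * x ≡ fromℕ t * x
  complement k t {x} kt·x≡1 = begin
    1# - fromℕ k * x                      ≡⟨ cong (_- fromℕ k * x) (sym kt·x≡1) ⟩
    fromℕ (k ℕ.+ t) * x - fromℕ k * x     ≡⟨ cong (λ u → u * x - fromℕ k * x) (fromℕ-+ k t) ⟩
    (fromℕ k + fromℕ t) * x - fromℕ k * x ≡⟨ solve 3 (λ K T x → (K :+ T) :* x :- K :* x := T :* x)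
                                                      refl (fromℕ k) (fromℕ t) x ⟩
    fromℕ t * x                           ∎

  μ-pos : ∀ t → 0# < μ (suc t)
  μ-pos t = ⁻¹-pos (fromℕ-pos t)

  μ-at-most-half : ∀ t → 0# ≤ᴿ 1# - fromℕ 2 * μ (2 ℕ.+ t)
  μ-at-most-half t = subst (0# ≤ᴿ_) (sym (complement 2 t (⁻¹-inverse _ (pos⇒≢0 (fromℕ-pos (suc t))))))
                           (nonneg*nonneg (fromℕ-nonneg t) (inj₁ (μ-pos (suc t))))

  -- Lemma 6 for σ = t + 2 and d = k + 2: the root exceeds 3μ/2, so s = μ/λ is
  -- in (0, 2/3), which gives both the eigenvector property and the norm bound.
  dominant-root-eigenpair : ∀ t k {l} → let σ = 2 ℕ.+ t; d = 2 ℕ.+ k; s = μ σ * l ⁻¹ in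
    f σ d l ≡ 0# → 1# - μ σ ^ d < l →
    (∀ i → (A σ d ·ᵥ ν d s) i ≡ l * ν d s i) × ‖ ν d s ‖₁ < fromℕ 3
  dominant-root-eigenpair t k root above =
    let 0<μ                = μ-pos (suc t)
        μ<l , 0<s , 0<2-3s = ratio-bounds 0<μ (above-three-halves k 0<μ (μ-at-most-half t) above)
    in ν-eigenvector (2 ℕ.+ t) (2 ℕ.+ k) 0<μ μ<l root , ν-norm-bound (2 ℕ.+ k) 0<s 0<2-3s

lemma6 : (R : RealField) → let open RealFieldOps R renaming (_≤_ to _≤ᴿ_) in
    (σ : ℕ) → 2 ≤ σ →
    ∃ λ d₀ → (d : ℕ) → d₀ ≤ d → (λ₀ : Carrier) →
      f σ d λ₀ ≡ 0# →
      1# - μ σ ^ d < λ₀ →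
      λ₀ < 1# - μ σ ^ suc d →
      (∀ i → (A σ d ·ᵥ ν d (μ σ * λ₀ ⁻¹)) i ≡ λ₀ * ν d (μ σ * λ₀ ⁻¹) i)
      × ‖ ν d (μ σ * λ₀ ⁻¹) ‖₁ < fromℕ 3
-- The theorem, with d₀ = 2.
lemma6 R (suc (suc t)) (s≤s (s≤s _)) = 2 , λ where
  (suc (suc k)) (s≤s (s≤s _)) λ₀ root above _ → DominantEigenvector.dominant-root-eigenpair R t k root above
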